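{- For any node $x$ of a top tree in which all clusters are valid and the orientation invariant holds, every $\mathrm{rotate\_up}$ operation performed during $\mathrm{semi\_splay\_step}(x)$ is allowed (i.e. a semi-splay step never makes an invalid rotation).
   Context: Let $F$ be a forest (the underlying forest) in which some vertices are marked as exposed. For a set $C$ of edges of $F$, a vertex $w$ is a boundary vertex of $C$ if $w$ is incident to an edge of $C$ and either $w$ is exposed or $w$ is incident to an edge of $F$ not in $C$. A cluster is a nonempty connected set of edges; it is valid if it has at most two boundary vertices; a valid cluster is a path cluster if it has exactly two boundary vertices and a point cluster if it has zero or one. A top tree for a tree $T$ of $F$ (with at least one edge) is a rooted tree in which every internal node has exactly two children and whose leaves are in bijection with the edges of $T$; each node is identified with the cluster of edges at the leaves of its subtree, every such cluster being connected and valid. The two children of an internal node share exactly one vertex, its central vertex. Orientation: each internal node has ordered children (left, right), each leaf has ordered endpoints (left, right). For a leaf, a boundary vertex is its left/right boundary vertex if it is its left/right endpoint; for an internal node, a boundary vertex is middle if it equals the central vertex, and otherwise left/right according to whether it is a boundary vertex of the left/right child. Leftmost boundary vertex: the left one if it exists, else the middle one if it exists, else none; rightmost symmetric. Orientation invariant: for every internal node, the rightmost boundary vertex of the left child and the leftmost boundary vertex of the right child exist and equal the central vertex. Two nodes hang off to the same side if both are left children or both are right children of their respective parents. Rotation: for a node $u$ with parent $y$ and grandparent $z$, with $a=\mathrm{sibling}(u)$, $b=\mathrm{sibling}(y)$, $\mathrm{rotate\_up}(u)$ is allowed iff $a\cup b$ is a valid cluster; it makes $a,b$ the children of $y$ and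 $u,y$ the children of $z$ (other parent–child relations unchanged), then adjusts child orders and orientations (possibly reversing orientations of whole subtrees) so that the orientation invariant holds. Semi-splay step: $\mathrm{semi\_splay\_step}(x)$ does the following. Let $p$ be the parent and $g$ the grandparent of $x$; if either does not exist, return null without changes. If $x$ and $g$ are both point clusters, perform $\mathrm{rotate\_up}(x)$ and return $g$. Otherwise let $gg$ be the parent of $g$; if it does not exist, return null. If $p$ is a path cluster and ($g$ is a path cluster or $gg$ is a point cluster), then: if $x$ and $p$ hang off to the same side, perform $\mathrm{rotate\_up}(x)$ and return $g$; else if $p$ and $g$ hang off to the same side, perform $\mathrm{rotate\_up}(p)$ and return $gg$; else (then $x$ and $g$ hang off to the same side) perform $\mathrm{rotate\_up}(\mathrm{sibling}(x))$ followed by $\mathrm{rotate\_up}(p)$ and return $gg$. In all remaining cases, return $\mathrm{semi\_splay\_step}(p)$. -}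

module Defs where

open import Data.Nat using (ℕ)
open import Data.Fin using (Fin)
open import Data.Bool using (Bool; true)
open import Data.Product using (Σ; ∃; ∃-syntax; _×_; _,_; proj₁; proj₂)
open import Data.Sum using (_⊎_)
open import Data.Unit using (⊤)
open import Data.Empty using (⊥)
open import Data.List using (List; []; _∷_; _++_; allFin)
open import Data.List.Membership.Propositional using (_∈_; _∉_)
open import Data.List.Relation.Unary.Unique.Propositional using (Unique)
open import Data.Maybe using (Maybe; just; nothing)
open import Relation.Nullary using (¬_)
open import Relation.Binary.PropositionalEquality using (_≡_; _≢_)

record Forest : Set where
  field
    n       : ℕ
    m       : ℕ
    ends    : Fin m → Fin n × Fin n
    exposed : Fin n → Bool

module _ (F : Forest) where
  open Forest F

  V : Set
  V = Fin n

  E : Set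
  E = Fin m

  Incident : V → E → Set
  Incident w e = (w ≡ proj₁ (ends e)) ⊎ (w ≡ proj₂ (ends e))

  Joins : E → V → V → Set
  Joins e u v = (ends e ≡ (u , v)) ⊎ (ends e ≡ (v , u))

  -- Walk u v es vs : a walk from u to v using the edges es (in order),
  -- vs is the list of vertices visited, excluding the final vertex v.
  data Walk : V → V → List E → List V → Set where
    stop : ∀ {v} → Walk v v [] []
    step : ∀ {u w v e es vs} → Joins e u w → Walk w v es vs →
           Walk u v (e ∷ es) (u ∷ vs)

  Cycle : Set
  Cycle = Σ V λ v → Σ (List E) λ es → Σ (List V) λ vs →
          Walk v v es vs × es ≢ [] × Unique es × Unique vs

  IsForest : Set
  IsForest = ¬ Cycle

  ShareVertex : E → E → Set
  ShareVertex e e' = ∃[ w ] (Incident w e × Incident w e')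

  data Chain (C : List E) : E → E → Set where
    here : ∀ {e} → e ∈ C → Chain C e e
    next : ∀ {e e' e''} → e ∈ C → ShareVertex e e' → Chain C e' e'' →
           Chain C e e''

  Connected : List E → Set
  Connected C = ∀ e e' → e ∈ C → e' ∈ C → Chain C e e'

  Boundary : List E → V → Set
  Boundary C w = (∃[ e ] (e ∈ C × Incident w e)) ×
                 ((exposed w ≡ true) ⊎ (∃[ e ] (e ∉ C × Incident w e)))

  AtMostTwoBoundary : List E → Set
  AtMostTwoBoundary C = ∀ w₁ w₂ w₃ → Boundary C w₁ → Boundary C w₂ →
    Boundary C w₃ → (w₁ ≡ w₂) ⊎ (w₁ ≡ w₃) ⊎ (w₂ ≡ w₃)

  ValidCluster : List E → Set
  ValidCluster C = (C ≢ []) × Connected C × AtMostTwoBoundary C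

  PathCluster : List E → Set
  PathCluster C = ValidCluster C ×
    (∃[ w₁ ] ∃[ w₂ ] (w₁ ≢ w₂ × Boundary C w₁ × Boundary C w₂))

  PointCluster : List E → Set
  PointCluster C = ValidCluster C ×
    (∀ w₁ w₂ → Boundary C w₁ → Boundary C w₂ → w₁ ≡ w₂)

  -- Oriented top trees: leaf (left endpoint) (right endpoint) edge,
  -- internal node (left child) (right child).

  data TT : Set where
    leaf : V → V → E → TT
    node : TT → TT → TT

  edges : TT → List E
  edges (leaf _ _ e) = e ∷ []
  edges (node l r) = edges l ++ edges r

  LeavesOK : TT → Set
  LeavesOK (leaf a b e) = Joins e a b
  LeavesOK (node l r) = LeavesOK l × LeavesOK r

  -- t is a top tree for a tree T of F: the leaves are in bijection with
  -- the edges of a connected component T of F having at least one edge.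
  -- (Every cluster being connected and valid is 'AllValid' below.)
  IsTopTreeOfTreeOfF : TT → Set
  IsTopTreeOfTreeOfF t = LeavesOK t × Unique (edges t) ×
    (∃[ e₀ ] (e₀ ∈ edges t ×
      (∀ e → (e ∈ edges t → Chain (allFin m) e₀ e) ×
             (Chain (allFin m) e₀ e → e ∈ edges t))))

  AllValid : TT → Set
  AllValid t@(leaf _ _ _) = ValidCluster (edges t)
  AllValid t@(node l r) = ValidCluster (edges t) × AllValid l × AllValid r

  Central : TT → TT → V → Set
  Central l r w = (∃[ e ] (e ∈ edges l × Incident w e)) ×
                  (∃[ e ] (e ∈ edges r × Incident w e))

  LeftBV : TT → V → Set
  LeftBV t@(leaf a _ _) w = (w ≡ a) × Boundary (edges t) w
  LeftBV t@(node l r) w =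
    Boundary (edges t) w × ¬ Central l r w × Boundary (edges l) w

  RightBV : TT → V → Set
  RightBV t@(leaf _ b _) w = (w ≡ b) × Boundary (edges t) w
  RightBV t@(node l r) w =
    Boundary (edges t) w × ¬ Central l r w × Boundary (edges r) w

  MiddleBV : TT → V → Set
  MiddleBV (leaf _ _ _) w = ⊥
  MiddleBV t@(node l r) w = Boundary (edges t) w × Central l r w

  Leftmost : TT → V → Set
  Leftmost t w = LeftBV t w ⊎ ((∀ v → ¬ LeftBV t v) × MiddleBV t w)

  Rightmost : TT → V → Set
  Rightmost t w = RightBV t w ⊎ ((∀ v → ¬ RightBV t v) × MiddleBV t w)

  OrientInv : TT → Set
  OrientInv (leaf _ _ _) = ⊤
  OrientInv (node l r) =
    ((∃[ w ] Central l r w) ×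
     (∀ w → Central l r w → Rightmost l w × Leftmost r w) ×
     (∀ w → Rightmost l w → Central l r w) ×
     (∀ w → Leftmost r w → Central l r w)) ×
    OrientInv l × OrientInv r

  -- Addresses of nodes (read from the root; the last step is outermost)

  data Side : Set where
    L R : Side

  flip : Side → Side
  flip L = R
  flip R = L

  data Addr : Set where
    root : Addr
    _▹_  : Addr → Side → Addr

  child : Side → TT → Maybe TT
  child _ (leaf _ _ _) = nothing
  child L (node l r) = just l
  child R (node l r) = just r

  at : TT → Addr → Maybe TT
  at t root = just t
  at t (a ▹ s) with at t a
  ... | just c = child s c
  ... | nothing = nothing

  IsNode : TT → Addr → Set
  IsNode t a = ∃[ c ] (at t a ≡ just c)

  PointAt : TT → Addr → Set
  PointAt t a = ∃[ c ] (at t a ≡ just c × PointCluster (edges c))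

  PathAt : TT → Addr → Set
  PathAt t a = ∃[ c ] (at t a ≡ just c × PathCluster (edges c))

  -- rotate_up(u) is allowed iff u has a parent y and a grandparent z and
  -- sibling(u) ∪ sibling(y) is a valid cluster
  Allowed : TT → Addr → Set
  Allowed t ((z ▹ s₁) ▹ s₂) =
    ∃[ a ] ∃[ b ] (at t ((z ▹ s₁) ▹ flip s₂) ≡ just a ×
                   at t (z ▹ flip s₁) ≡ just b ×
                   ValidCluster (edges a ++ edges b))
  Allowed t _ = ⊥

  modChild : Side → (TT → TT) → TT → TT
  modChild _ f t@(leaf _ _ _) = t
  modChild L f (node l r) = node (f l) r
  modChild R f (node l r) = node l (f r)

  modify : Addr → (TT → TT) → TT → TT
  modify root f t = f t
  modify (a ▹ s) f t = modify a (modChild s f) t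

  -- local restructuring at z, where y = child s₁ of z and u = child s₂
  -- of y: afterwards u and y are the children of z (u on y's old side),
  -- and a = sibling(u), b = sibling(y) are the children of y.
  rotLocal : Side → Side → TT → TT
  rotLocal L L (node (node u a) b) = node u (node a b)
  rotLocal L R (node (node a u) b) = node u (node a b)
  rotLocal R L (node b (node u a)) = node (node b a) u
  rotLocal R R (node b (node a u)) = node (node b a) u
  rotLocal _ _ t = t

  rotateUp : TT → Addr → TT
  rotateUp t ((z ▹ s₁) ▹ s₂) = modify z (rotLocal s₁ s₂) t
  rotateUp t _ = t

  -- semi_splay_step(x), as a relation listing the rotations it performs,
  -- each paired with the tree on which it is performed.

  Rot : Set
  Rot = TT × Addr

  data SemiSplay (t : TT) : Addr → List Rot → Set where
    ss-noParent : SemiSplay t root []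
    ss-noGrand : ∀ s → SemiSplay t (root ▹ s) []
    ss-point : ∀ g sp sx →
      PointAt t ((g ▹ sp) ▹ sx) → PointAt t g →
      SemiSplay t ((g ▹ sp) ▹ sx) ((t , (g ▹ sp) ▹ sx) ∷ [])
    ss-noGG : ∀ sp sx →
      ¬ (PointAt t ((root ▹ sp) ▹ sx) × PointAt t root) →
      SemiSplay t ((root ▹ sp) ▹ sx) []
    ss-same : ∀ gg sg sp sx →
      ¬ (PointAt t (((gg ▹ sg) ▹ sp) ▹ sx) × PointAt t (gg ▹ sg)) →
      PathAt t ((gg ▹ sg) ▹ sp) →
      (PathAt t (gg ▹ sg) ⊎ PointAt t gg) →
      sx ≡ sp →
      SemiSplay t (((gg ▹ sg) ▹ sp) ▹ sx)
        ((t , ((gg ▹ sg) ▹ sp) ▹ sx) ∷ [])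
    ss-pg : ∀ gg sg sp sx →
      ¬ (PointAt t (((gg ▹ sg) ▹ sp) ▹ sx) × PointAt t (gg ▹ sg)) →
      PathAt t ((gg ▹ sg) ▹ sp) →
      (PathAt t (gg ▹ sg) ⊎ PointAt t gg) →
      sx ≢ sp → sp ≡ sg →
      SemiSplay t (((gg ▹ sg) ▹ sp) ▹ sx)
        ((t , (gg ▹ sg) ▹ sp) ∷ [])
    -- x, g hang off the same side: rotate_up(sibling x), then rotate_up(p)
    -- (after the first rotation p sits at g ▹ flip sp)
    ss-double : ∀ gg sg sp sx →
      ¬ (PointAt t (((gg ▹ sg) ▹ sp) ▹ sx) × PointAt t (gg ▹ sg)) →
      PathAt t ((gg ▹ sg) ▹ sp) →
      (PathAt t (gg ▹ sg) ⊎ PointAt t gg) →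
      sx ≢ sp → sp ≢ sg →
      SemiSplay t (((gg ▹ sg) ▹ sp) ▹ sx)
        ((t , ((gg ▹ sg) ▹ sp) ▹ flip sx) ∷
         (rotateUp t (((gg ▹ sg) ▹ sp) ▹ flip sx) , (gg ▹ sg) ▹ flip sp) ∷ [])
    ss-recurse : ∀ gg sg sp sx {rs} →
      ¬ (PointAt t (((gg ▹ sg) ▹ sp) ▹ sx) × PointAt t (gg ▹ sg)) →
      ¬ (PathAt t ((gg ▹ sg) ▹ sp) × (PathAt t (gg ▹ sg) ⊎ PointAt t gg)) →
      SemiSplay t ((gg ▹ sg) ▹ sp) rs →
      SemiSplay t (((gg ▹ sg) ▹ sp) ▹ sx) rs

-- Let rotate_up(u) act on u with parent y and grandparent z, a = sibling(u) and b = sibling(y).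
-- The central vertex cz of z lies on b and, in every rotation of a semi-splay step, also on a, so
-- a ∪ b is connected. A boundary vertex of a ∪ b that lies on u is the central vertex cy of y;
-- any other is a boundary vertex of z. Hence a ∪ b has at most two boundary vertices if z is a
-- point cluster. If y is a path cluster, take a boundary vertex q ≠ cz of y; it is one of z. If q
-- lies on a ∪ b it is cy, so a ∪ b has no boundary vertex outside z; otherwise q is a boundary
-- vertex of z that a ∪ b lacks. q cannot lie on a but not on u, because the orientation invariant
-- makes cz the only such boundary vertex of y. When u and z are point clusters, cz lies on a since
-- otherwise cz and cy would be two distinct boundary vertices of u.
-- The orientation invariant also makes central vertices unique.

module Submission where

open import Defs
open import Data.Fin using (_≟_)
open import Data.Product using (∃-syntax; _×_; _,_; proj₁; proj₂)
open import Data.Sum as Sum using (_⊎_; inj₁; inj₂; [_,_])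
open import Data.Empty using (⊥-elim)
open import Data.List using (List; []; _∷_; _++_)
open import Data.List.Membership.Propositional using (_∈_; _∉_; find; lose)
open import Data.List.Membership.Propositional.Properties using (∈-++⁻)
open import Data.List.Relation.Unary.Any using (here; there; any?)
open import Data.List.Relation.Unary.All using (All; []; _∷_)
open import Data.List.Relation.Unary.All.Properties using (++⁻ˡ; ++⁻ʳ)
import Data.List.Relation.Unary.All as All
open import Data.List.Relation.Unary.AllPairs using ([]; _∷_)
open import Data.List.Relation.Unary.Unique.Propositional using (Unique)
open import Data.List.Relation.Binary.Disjoint.Propositional using (Disjoint)
import Data.List.Relation.Binary.Disjoint.Setoid.Properties as Disjoint
open import Data.List.Relation.Binary.Subset.Propositional using (_⊆_)
open import Data.List.Relation.Binary.Subset.Propositional.Properties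
  using (xs⊆xs++ys; xs⊆ys++xs; ⊆-reflexive-↭)
open import Data.List.Relation.Binary.Permutation.Propositional
  using (_↭_; ↭-refl; ↭-sym; module PermutationReasoning)
open import Data.List.Relation.Binary.Permutation.Propositional.Properties
  using (++-comm; ++-assoc; ++⁺ˡ; ++⁺ʳ)
open import Data.Maybe as Maybe using (just; nothing; _>>=_)
open import Function using (_∘_; id)
open import Relation.Nullary using (¬_; Dec; yes; no)
open import Relation.Nullary.Decidable using (_⊎-dec_; map′)
open import Relation.Unary using (_∪_)
open import Relation.Binary.PropositionalEquality
  using (_≡_; _≢_; refl; sym; trans; cong; subst; setoid; module ≡-Reasoning)

AtMostOne : {A : Set} → (A → Set) → Set
AtMostOne P = ∀ x y → P x → P y → x ≡ y

AtMostTwo : {A : Set} → (A → Set) → Set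
AtMostTwo P = ∀ x y z → P x → P y → P z → (x ≡ y) ⊎ (x ≡ z) ⊎ (y ≡ z)

module _ {A : Set} {P Q : A → Set} where

  atMostTwo-mono : (∀ {x} → P x → Q x) → AtMostTwo Q → AtMostTwo P
  atMostTwo-mono P⇒Q Q≤2 x y z px py pz = Q≤2 x y z (P⇒Q px) (P⇒Q py) (P⇒Q pz)

  atMostOne-∪ : AtMostOne P → AtMostOne Q → AtMostTwo (P ∪ Q)
  atMostOne-∪ P≤1 Q≤1 x y z (inj₁ px) (inj₁ py) _         = inj₁ (P≤1 x y px py)
  atMostOne-∪ P≤1 Q≤1 x y z (inj₂ qx) (inj₂ qy) _         = inj₁ (Q≤1 x y qx qy)
  atMostOne-∪ P≤1 Q≤1 x y z (inj₁ px) (inj₂ qy) (inj₁ pz) = inj₂ (inj₁ (P≤1 x z px pz))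
  atMostOne-∪ P≤1 Q≤1 x y z (inj₁ px) (inj₂ qy) (inj₂ qz) = inj₂ (inj₂ (Q≤1 y z qy qz))
  atMostOne-∪ P≤1 Q≤1 x y z (inj₂ qx) (inj₁ py) (inj₁ pz) = inj₂ (inj₂ (P≤1 y z py pz))
  atMostOne-∪ P≤1 Q≤1 x y z (inj₂ qx) (inj₁ py) (inj₂ qz) = inj₂ (inj₁ (Q≤1 x z qx qz))

atMostTwo-remove : {A : Set} {P : A → Set} {z : A} →
  AtMostTwo P → P z → AtMostOne (λ x → P x × x ≢ z)
atMostTwo-remove {z = z} P≤2 pz x y (px , x≢z) (py , y≢z) with P≤2 x y z px py pz
... | inj₁ x≡y        = x≡y
... | inj₂ (inj₁ x≡z) = ⊥-elim (x≢z x≡z)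
... | inj₂ (inj₂ y≡z) = ⊥-elim (y≢z y≡z)

≡-atMostOne : {A : Set} (c : A) → AtMostOne (_≡ c)
≡-atMostOne c x y x≡c y≡c = trans x≡c (sym y≡c)

unique-++⁻ : {A : Set} (xs : List A) {ys : List A} →
  Unique (xs ++ ys) → Unique xs × Unique ys × Disjoint xs ys
unique-++⁻ []       u            = [] , u , λ ()
unique-++⁻ (x ∷ xs) (x∉ ∷ u) with unique-++⁻ xs u
... | uxs , uys , xs#ys = ++⁻ˡ xs x∉ ∷ uxs , uys , x∷xs#ys
  where
  x∷xs#ys : Disjoint (x ∷ xs) _
  x∷xs#ys (here refl , v∈ys) = All.lookup (++⁻ʳ xs x∉) v∈ys refl
  x∷xs#ys (there v∈xs , v∈ys) = xs#ys (v∈xs , v∈ys)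

module TopTreeRotations (F : Forest) where

  Touches : List (E F) → V F → Set
  Touches C w = ∃[ e ] (e ∈ C × Incident F w e)

  touches? : ∀ C w → Dec (Touches C w)
  touches? C w = map′ find (λ (e , e∈C , i) → lose e∈C i) (any? incident? C)
    where
    incident? : ∀ e → Dec (Incident F w e)
    incident? e = (w ≟ proj₁ (Forest.ends F e)) ⊎-dec (w ≟ proj₂ (Forest.ends F e))

  touches-mono : ∀ {C D w} → C ⊆ D → Touches C w → Touches D w
  touches-mono C⊆D (e , e∈C , i) = e , C⊆D e∈C , i

  touches-++⁻ : ∀ C {D w} → Touches (C ++ D) w → Touches C w ⊎ Touches D w
  touches-++⁻ C (e , e∈CD , i) =
    Sum.map (λ e∈C → e , e∈C , i) (λ e∈D → e , e∈D , i) (∈-++⁻ C e∈CD)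

  MeetAt : List (E F) → List (E F) → V F → Set
  MeetAt C D c = (Touches C c × Touches D c) × (∀ {w} → Touches C w → Touches D w → w ≡ c)

  meetAt-sym : ∀ {C D c} → MeetAt C D c → MeetAt D C c
  meetAt-sym ((cC , cD) , only-c) = (cD , cC) , λ wD wC → only-c wC wD

  meetAt-++ : ∀ {C D X A c₁ c₂} → MeetAt C D c₁ → MeetAt X A c₂ → A ⊆ D → Touches X c₁ →
    MeetAt (C ++ X) A c₂
  meetAt-++ {C} {D} {X} {A} {c₁} {c₂} (_ , only-c₁) ((c₂X , c₂A) , only-c₂) A⊆D c₁X =
    (touches-mono (xs⊆ys++xs X C) c₂X , c₂A) , shared
    where
    shared : ∀ {w} → Touches (C ++ X) w → Touches A w → w ≡ c₂
    shared wCX wA with touches-++⁻ C wCX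
    ... | inj₂ wX = only-c₂ wX wA
    ... | inj₁ wC with only-c₁ wC (touches-mono A⊆D wA)
    ...   | refl = only-c₂ c₁X wA

  boundary-⊆ : ∀ {C D w} → C ⊆ D → Touches C w → Boundary F D w → Boundary F C w
  boundary-⊆ C⊆D wC (_ , inj₁ exposed)           = wC , inj₁ exposed
  boundary-⊆ C⊆D wC (_ , inj₂ (e , e∉D , i)) = wC , inj₂ (e , e∉D ∘ C⊆D , i)

  boundary-extend : ∀ {C D} O {w} → C ⊆ D → D ⊆ C ++ O → ¬ Touches O w →
    Boundary F C w → Boundary F D w
  boundary-extend O C⊆D D⊆CO w∉O (wC , inj₁ exposed) = touches-mono C⊆D wC , inj₁ exposed
  boundary-extend {C} {D} O C⊆D D⊆CO w∉O (wC , inj₂ (e , e∉C , i)) =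
    touches-mono C⊆D wC , inj₂ (e , e∉D , i)
    where
    e∉D : e ∉ D
    e∉D e∈D = [ e∉C , (λ e∈O → w∉O (e , e∈O , i)) ] (∈-++⁻ C (D⊆CO e∈D))

  shared-boundary : ∀ {C D w} → Disjoint C D → Touches C w → Touches D w → Boundary F C w
  shared-boundary C#D wC (e , e∈D , i) = wC , inj₂ (e , (λ e∈C → C#D (e∈C , e∈D)) , i)

  path-boundary-avoiding : ∀ {C} → PathCluster F C → ∀ c → ∃[ q ] (Boundary F C q × q ≢ c)
  path-boundary-avoiding (_ , q₁ , q₂ , q₁≢q₂ , q₁C , q₂C) c with q₁ ≟ c
  ... | yes refl  = q₂ , q₂C , q₁≢q₂ ∘ sym
  ... | no q₁≢c = q₁ , q₁C , q₁≢c

  chain-mono : ∀ {C D e e'} → C ⊆ D → Chain F C e e' → Chain F D e e'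
  chain-mono C⊆D (here e∈C)          = here (C⊆D e∈C)
  chain-mono C⊆D (next e∈C share c) = next (C⊆D e∈C) share (chain-mono C⊆D c)

  chain-append : ∀ {C e₁ e₂ e₃ e₄} → Chain F C e₁ e₂ → ShareVertex F e₂ e₃ → Chain F C e₃ e₄ →
    Chain F C e₁ e₄
  chain-append (here e₁∈C)          share c = next e₁∈C share c
  chain-append (next e₁∈C share' c') share c = next e₁∈C share' (chain-append c' share c)

  connected-++ : ∀ {C D w} → Connected F C → Connected F D → Touches C w → Touches D w →
    Connected F (C ++ D)
  connected-++ {C} {D} {w} conC conD (c , c∈C , wc) (d , d∈D , wd) e e' e∈ e'∈ =
    join (∈-++⁻ C e∈) (∈-++⁻ C e'∈)
    where
    inˡ : C ⊆ C ++ D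
    inˡ = xs⊆xs++ys C D
    inʳ : D ⊆ C ++ D
    inʳ = xs⊆ys++xs D C
    join : e ∈ C ⊎ e ∈ D → e' ∈ C ⊎ e' ∈ D → Chain F (C ++ D) e e'
    join (inj₁ e∈C) (inj₁ e'∈C) = chain-mono inˡ (conC e e' e∈C e'∈C)
    join (inj₂ e∈D) (inj₂ e'∈D) = chain-mono inʳ (conD e e' e∈D e'∈D)
    join (inj₁ e∈C) (inj₂ e'∈D) =
      chain-append (chain-mono inˡ (conC e c e∈C c∈C)) (w , wc , wd)
                   (chain-mono inʳ (conD d e' d∈D e'∈D))
    join (inj₂ e∈D) (inj₁ e'∈C) =
      chain-append (chain-mono inʳ (conD e d e∈D d∈D)) (w , wd , wc)
                   (chain-mono inˡ (conC c e' c∈C e'∈C))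

  valid-++ : ∀ {C D w} → ValidCluster F C → ValidCluster F D → Touches C w → Touches D w →
    AtMostTwoBoundary F (C ++ D) → ValidCluster F (C ++ D)
  valid-++ {[]}    (C≢[] , _) _ _ _ _ = ⊥-elim (C≢[] refl)
  valid-++ {_ ∷ _} (_ , conC , _) (_ , conD , _) wC wD ≤2 =
    (λ ()) , connected-++ conC conD wC wD , ≤2

  OnlyBoundaryAwayFrom : List (E F) → List (E F) → List (E F) → V F → Set
  OnlyBoundaryAwayFrom Y U A c = ∀ {q} → Boundary F Y q → Touches A q → ¬ Touches U q → q ≡ c

  -- Edge sets of u, a, b, y, z in rotate_up(u); cy and cz are the central vertices of y and z.
  module Rotation {U A B Y Z : List (E F)} (Y↭UA : Y ↭ U ++ A) (Z↭YB : Z ↭ Y ++ B)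
                  {cy cz : V F} (y-meet : MeetAt U A cy) (z-meet : MeetAt Y B cz) where

    private
      U⊆Y : U ⊆ Y
      U⊆Y = ⊆-reflexive-↭ (↭-sym Y↭UA) ∘ xs⊆xs++ys U A

      Y⊆Z : Y ⊆ Z
      Y⊆Z = ⊆-reflexive-↭ (↭-sym Z↭YB) ∘ xs⊆xs++ys Y B

      Z↭ABU : Z ↭ (A ++ B) ++ U
      Z↭ABU = begin
        Z               ↭⟨ Z↭YB ⟩
        Y ++ B          ↭⟨ ++⁺ʳ B Y↭UA ⟩
        (U ++ A) ++ B   ↭⟨ ++-assoc U A B ⟩
        U ++ (A ++ B)   ↭⟨ ++-comm U (A ++ B) ⟩
        (A ++ B) ++ U   ∎
        where open PermutationReasoning

      AB⊆Z : A ++ B ⊆ Z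
      AB⊆Z = ⊆-reflexive-↭ (↭-sym Z↭ABU) ∘ xs⊆xs++ys (A ++ B) U

      only-cy : ∀ {w} → Touches U w → Touches A w → w ≡ cy
      only-cy = proj₂ y-meet

      only-cz : ∀ {w} → Touches Y w → Touches B w → w ≡ cz
      only-cz = proj₂ z-meet

    siblings-boundary : Touches A cz → ∀ {w} → Boundary F (A ++ B) w → Boundary F Z w ⊎ w ≡ cy
    siblings-boundary czA {w} wAB with touches? U w
    ... | no w∉U = inj₁ (boundary-extend U AB⊆Z (⊆-reflexive-↭ Z↭ABU) w∉U wAB)
    ... | yes wU with touches-++⁻ A (proj₁ wAB)
    ...   | inj₁ wA = inj₂ (only-cy wU wA)
    ...   | inj₂ wB with only-cz (touches-mono U⊆Y wU) wB
    ...     | refl = inj₂ (only-cy wU czA)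

    -- q is a boundary vertex of z: if it lies on a ∪ b it is cy, so every boundary vertex of
    -- a ∪ b is one of z; otherwise a ∪ b misses q, leaving room for cy.
    siblings-boundary-path : Touches A cz → AtMostTwoBoundary F Z →
      ∀ {q} → Boundary F Y q → q ≢ cz → (Touches A q → ¬ Touches U q → q ≡ cz) →
      AtMostTwoBoundary F (A ++ B)
    siblings-boundary-path czA Z≤2 {q} qY q≢cz outer = bound (touches? (A ++ B) q)
      where
      q∉B : ¬ Touches B q
      q∉B qB = q≢cz (only-cz (proj₁ qY) qB)

      qZ : Boundary F Z q
      qZ = boundary-extend B Y⊆Z (⊆-reflexive-↭ Z↭YB) q∉B qY

      q≡cy : Touches (A ++ B) q → q ≡ cy
      q≡cy qAB with touches-++⁻ A qAB
      ... | inj₂ qB = ⊥-elim (q∉B qB)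
      ... | inj₁ qA with touches? U q
      ...   | yes qU = only-cy qU qA
      ...   | no q∉U = ⊥-elim (q≢cz (outer qA q∉U))

      bound : Dec (Touches (A ++ B) q) → AtMostTwoBoundary F (A ++ B)
      bound (yes qAB) = atMostTwo-mono
        ([ id , (λ { refl → subst (Boundary F Z) (q≡cy qAB) qZ }) ] ∘ siblings-boundary czA) Z≤2
      bound (no q∉AB) = atMostTwo-mono
        (λ wAB → Sum.map₁ (λ wZ → wZ , λ { refl → q∉AB (proj₁ wAB) }) (siblings-boundary czA wAB))
        (atMostOne-∪ (atMostTwo-remove Z≤2 qZ) (≡-atMostOne cy))

    siblings-valid : Touches A cz → ValidCluster F A → ValidCluster F B → ValidCluster F Z →
      (PathCluster F Y × OnlyBoundaryAwayFrom Y U A cz) ⊎ PointCluster F Z →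
      ValidCluster F (A ++ B)
    siblings-valid czA vA vB vZ shape = valid-++ vA vB czA (proj₂ (proj₁ z-meet)) (bound shape)
      where
      bound : (PathCluster F Y × OnlyBoundaryAwayFrom Y U A cz) ⊎ PointCluster F Z →
        AtMostTwoBoundary F (A ++ B)
      bound (inj₁ (Ypath , outer)) with path-boundary-avoiding Ypath cz
      ... | q , qY , q≢cz = siblings-boundary-path czA (proj₂ (proj₂ vZ)) qY q≢cz (outer qY)
      bound (inj₂ (_ , Z≤1)) =
        atMostTwo-mono (siblings-boundary czA) (atMostOne-∪ Z≤1 (≡-atMostOne cy))

    point-touches : Disjoint U A → Disjoint Y B → PointCluster F U → Touches A cz
    point-touches U#A Y#B (_ , U≤1) =
      [ cz-on-U , id ] (touches-++⁻ U (touches-mono (⊆-reflexive-↭ Y↭UA) (proj₁ czY)))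
      where
      cyU : Boundary F U cy
      cyU = shared-boundary U#A (proj₁ (proj₁ y-meet)) (proj₂ (proj₁ y-meet))

      czY : Boundary F Y cz
      czY = shared-boundary Y#B (proj₁ (proj₁ z-meet)) (proj₂ (proj₁ z-meet))

      cz-on-U : Touches U cz → Touches A cz
      cz-on-U czU =
        subst (Touches A) (U≤1 cy cz cyU (boundary-⊆ U⊆Y czU czY)) (proj₂ (proj₁ y-meet))

    point-siblings-valid : Disjoint U A → Disjoint Y B → ValidCluster F A → ValidCluster F B →
      PointCluster F U → PointCluster F Z → ValidCluster F (A ++ B)
    point-siblings-valid U#A Y#B vA vB pU pZ =
      siblings-valid (point-touches U#A Y#B pU) vA vB (proj₁ pZ) (inj₂ pZ)

  open Rotation

  record WellFormed (t : TT F) : Set where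
    constructor well-formed
    field
      unique : Unique (edges F t)
      valid  : AllValid F t
      orient : OrientInv F t

  open WellFormed

  wf-valid : ∀ {t} → WellFormed t → ValidCluster F (edges F t)
  wf-valid {leaf _ _ _} wf = valid wf
  wf-valid {node _ _}   wf = proj₁ (valid wf)

  module _ {l r : TT F} (wf : WellFormed (node l r)) where

    wf-left : WellFormed l
    wf-left = well-formed (proj₁ (unique-++⁻ (edges F l) (unique wf)))
                          (proj₁ (proj₂ (valid wf))) (proj₁ (proj₂ (orient wf)))

    wf-right : WellFormed r
    wf-right = well-formed (proj₁ (proj₂ (unique-++⁻ (edges F l) (unique wf))))
                           (proj₂ (proj₂ (valid wf))) (proj₂ (proj₂ (orient wf)))

    wf-disjoint : Disjoint (edges F l) (edges F r)
    wf-disjoint = proj₂ (proj₂ (unique-++⁻ (edges F l) (unique wf)))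

    centre : V F
    centre = proj₁ (proj₁ (proj₁ (orient wf)))

    centre-central : Central F l r centre
    centre-central = proj₂ (proj₁ (proj₁ (orient wf)))

    central-rightmost : ∀ {w} → Central F l r w → Rightmost F l w
    central-rightmost {w} cw = proj₁ (proj₁ (proj₂ (proj₁ (orient wf))) w cw)

    central-leftmost : ∀ {w} → Central F l r w → Leftmost F r w
    central-leftmost {w} cw = proj₂ (proj₁ (proj₂ (proj₁ (orient wf))) w cw)

  rightmost-touches-right : ∀ {l r w} → Rightmost F (node l r) w → Touches (edges F r) w
  rightmost-touches-right (inj₁ (_ , _ , wr))      = proj₁ wr
  rightmost-touches-right (inj₂ (_ , _ , (_ , wr))) = wr

  leftmost-touches-left : ∀ {l r w} → Leftmost F (node l r) w → Touches (edges F l) w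
  leftmost-touches-left (inj₁ (_ , _ , wl))      = proj₁ wl
  leftmost-touches-left (inj₂ (_ , _ , (wl , _))) = wl

  rightmost-of-boundary : ∀ {l r w} → Boundary F (edges F (node l r)) w → ¬ Touches (edges F l) w →
    Rightmost F (node l r) w
  rightmost-of-boundary {l} {r} {w} bw w∉l =
    inj₁ (bw , w∉l ∘ proj₁ , boundary-⊆ (xs⊆ys++xs (edges F r) (edges F l)) wr bw)
    where
    wr : Touches (edges F r) w
    wr = [ (λ wl → ⊥-elim (w∉l wl)) , id ] (touches-++⁻ (edges F l) (proj₁ bw))

  leftmost-of-boundary : ∀ {l r w} → Boundary F (edges F (node l r)) w → ¬ Touches (edges F r) w →
    Leftmost F (node l r) w
  leftmost-of-boundary {l} {r} {w} bw w∉r =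
    inj₁ (bw , w∉r ∘ proj₂ , boundary-⊆ (xs⊆xs++ys (edges F l) (edges F r)) wl bw)
    where
    wl : Touches (edges F l) w
    wl = [ id , (λ wr → ⊥-elim (w∉r wr)) ] (touches-++⁻ (edges F l) (proj₁ bw))

  disjoint-sym : ∀ {C D : List (E F)} → Disjoint C D → Disjoint D C
  disjoint-sym = Disjoint.sym (setoid (E F))

  rightmost-unique : ∀ {t} → WellFormed t → ∀ {w w'} →
    Rightmost F t w → Rightmost F t w' → w ≡ w'
  rightmost-unique {leaf _ _ _} _ (inj₁ (refl , _)) (inj₁ (refl , _)) = refl
  rightmost-unique {leaf _ _ _} _ (inj₁ _) (inj₂ (_ , ()))
  rightmost-unique {leaf _ _ _} _ (inj₂ (_ , ())) _
  rightmost-unique {node _ _} _ (inj₁ rw) (inj₂ (no-right , _)) = ⊥-elim (no-right _ rw)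
  rightmost-unique {node _ _} _ (inj₂ (no-right , _)) (inj₁ rw') = ⊥-elim (no-right _ rw')
  rightmost-unique {node _ _} wf (inj₂ (_ , _ , cw)) (inj₂ (_ , _ , cw')) =
    rightmost-unique (wf-left wf) (central-rightmost wf cw) (central-rightmost wf cw')
  rightmost-unique {node l r} wf (inj₁ (_ , w∉c , wr)) (inj₁ (_ , w'∉c , w'r)) =
    atMostTwo-remove (proj₂ (proj₂ (wf-valid (wf-right wf)))) cr _ _
      (wr , λ { refl → w∉c (centre-central wf) }) (w'r , λ { refl → w'∉c (centre-central wf) })
    where
    cr : Boundary F (edges F r) (centre wf)
    cr = shared-boundary (disjoint-sym (wf-disjoint wf))
           (proj₂ (centre-central wf)) (proj₁ (centre-central wf))

  leftmost-unique : ∀ {t} → WellFormed t → ∀ {w w'} →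
    Leftmost F t w → Leftmost F t w' → w ≡ w'
  leftmost-unique {leaf _ _ _} _ (inj₁ (refl , _)) (inj₁ (refl , _)) = refl
  leftmost-unique {leaf _ _ _} _ (inj₁ _) (inj₂ (_ , ()))
  leftmost-unique {leaf _ _ _} _ (inj₂ (_ , ())) _
  leftmost-unique {node _ _} _ (inj₁ lw) (inj₂ (no-left , _)) = ⊥-elim (no-left _ lw)
  leftmost-unique {node _ _} _ (inj₂ (no-left , _)) (inj₁ lw') = ⊥-elim (no-left _ lw')
  leftmost-unique {node _ _} wf (inj₂ (_ , _ , cw)) (inj₂ (_ , _ , cw')) =
    leftmost-unique (wf-right wf) (central-leftmost wf cw) (central-leftmost wf cw')
  leftmost-unique {node l r} wf (inj₁ (_ , w∉c , wl)) (inj₁ (_ , w'∉c , w'l)) =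
    atMostTwo-remove (proj₂ (proj₂ (wf-valid (wf-left wf)))) cl _ _
      (wl , λ { refl → w∉c (centre-central wf) }) (w'l , λ { refl → w'∉c (centre-central wf) })
    where
    cl : Boundary F (edges F l) (centre wf)
    cl = shared-boundary (wf-disjoint wf) (proj₁ (centre-central wf)) (proj₂ (centre-central wf))

  centre-meet : ∀ {l r} (wf : WellFormed (node l r)) → MeetAt (edges F l) (edges F r) (centre wf)
  centre-meet wf = centre-central wf , λ wl wr → rightmost-unique (wf-left wf)
    (central-rightmost wf (wl , wr)) (central-rightmost wf (centre-central wf))

  -- The boundary vertex q of p = node x a other than the central vertex of g is the rightmost one
  -- of g, and it lies on a, since otherwise it would be the leftmost boundary vertex of p.
  rightmost-touches-right-grandchild : ∀ {l x a w} → WellFormed (node l (node x a)) →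
    PathCluster F (edges F (node x a)) → Rightmost F (node l (node x a)) w → Touches (edges F a) w
  rightmost-touches-right-grandchild {l} {x} {a} {w} wf p-path rw
    with path-boundary-avoiding p-path (centre wf)
  ... | q , qp , q≢c with touches? (edges F a) q
  ...   | yes qa  = subst (Touches (edges F a)) q≡w qa
    where
    q∉l : ¬ Touches (edges F l) q
    q∉l ql = q≢c (proj₂ (centre-meet wf) ql (proj₁ qp))

    p : List (E F)
    p = edges F (node x a)

    q≡w : q ≡ w
    q≡w = rightmost-unique wf (rightmost-of-boundary {l} {node x a} (boundary-extend (edges F l)
            (xs⊆ys++xs p (edges F l)) (⊆-reflexive-↭ (++-comm (edges F l) p)) q∉l qp) q∉l) rw
  ...   | no q∉a = ⊥-elim (q≢c (leftmost-unique (wf-right wf)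
            (leftmost-of-boundary {x} {a} qp q∉a) (central-leftmost wf (centre-central wf))))

  leftmost-touches-left-grandchild : ∀ {a x r w} → WellFormed (node (node a x) r) →
    PathCluster F (edges F (node a x)) → Leftmost F (node (node a x) r) w → Touches (edges F a) w
  leftmost-touches-left-grandchild {a} {x} {r} {w} wf p-path lw
    with path-boundary-avoiding p-path (centre wf)
  ... | q , qp , q≢c with touches? (edges F a) q
  ...   | yes qa  = subst (Touches (edges F a)) q≡w qa
    where
    q∉r : ¬ Touches (edges F r) q
    q∉r qr = q≢c (proj₂ (centre-meet wf) (proj₁ qp) qr)

    q≡w : q ≡ w
    q≡w = leftmost-unique wf (leftmost-of-boundary {node a x} {r} (boundary-extend (edges F r)
            (xs⊆xs++ys (edges F (node a x)) (edges F r)) id q∉r qp) q∉r) lw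
  ...   | no q∉a = ⊥-elim (q≢c (rightmost-unique (wf-left wf)
            (rightmost-of-boundary {a} {x} qp q∉a) (central-rightmost wf (centre-central wf))))

  same-side-allowed : ∀ s {z y u s'} → WellFormed z → child F s z ≡ just y → child F s' y ≡ just u →
    PathCluster F (edges F y) ⊎ PointCluster F (edges F z) → Allowed F z ((root ▹ s) ▹ s)
  same-side-allowed L {node (node u a) b} wf refl _ shape =
    a , b , refl , refl ,
    siblings-valid ↭-refl ↭-refl (centre-meet wfy) (centre-meet wf)
      (rightmost-touches-right {u} {a} cz-rightmost)
      (wf-valid (wf-right wfy)) (wf-valid (wf-right wf)) (wf-valid wf) (Sum.map₁ (_, outer) shape)
    where
    wfy : WellFormed (node u a)
    wfy = wf-left wf

    cz-rightmost : Rightmost F (node u a) (centre wf)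
    cz-rightmost = central-rightmost wf (centre-central wf)

    outer : OnlyBoundaryAwayFrom (edges F (node u a)) (edges F u) (edges F a) (centre wf)
    outer qy _ q∉u = rightmost-unique wfy (rightmost-of-boundary {u} {a} qy q∉u) cz-rightmost
  same-side-allowed R {node b (node a u)} wf refl _ shape =
    a , b , refl , refl ,
    siblings-valid (++-comm (edges F a) (edges F u)) (++-comm (edges F b) (edges F (node a u)))
      (meetAt-sym (centre-meet wfy)) (meetAt-sym (centre-meet wf))
      (leftmost-touches-left {a} {u} cz-leftmost)
      (wf-valid (wf-left wfy)) (wf-valid (wf-left wf)) (wf-valid wf) (Sum.map₁ (_, outer) shape)
    where
    wfy : WellFormed (node a u)
    wfy = wf-right wf

    cz-leftmost : Leftmost F (node a u) (centre wf)
    cz-leftmost = central-leftmost wf (centre-central wf)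

    outer : OnlyBoundaryAwayFrom (edges F (node a u)) (edges F u) (edges F a) (centre wf)
    outer qy _ q∉u = leftmost-unique wfy (leftmost-of-boundary {a} {u} qy q∉u) cz-leftmost
  same-side-allowed L {node (leaf _ _ _) _} _ refl () _
  same-side-allowed R {node _ (leaf _ _ _)} _ refl () _

  point-allowed : ∀ s₁ s₂ {z y u} → WellFormed z → child F s₁ z ≡ just y → child F s₂ y ≡ just u →
    PointCluster F (edges F u) → PointCluster F (edges F z) → Allowed F z ((root ▹ s₁) ▹ s₂)
  point-allowed L L {node (node u a) b} wf refl refl pu pz =
    a , b , refl , refl ,
    point-siblings-valid ↭-refl ↭-refl (centre-meet wfy) (centre-meet wf)
      (wf-disjoint wfy) (wf-disjoint wf) (wf-valid (wf-right wfy)) (wf-valid (wf-right wf)) pu pz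
    where
    wfy : WellFormed (node u a)
    wfy = wf-left wf
  point-allowed L R {node (node a u) b} wf refl refl pu pz =
    a , b , refl , refl ,
    point-siblings-valid (++-comm (edges F a) (edges F u)) ↭-refl
      (meetAt-sym (centre-meet wfy)) (centre-meet wf)
      (disjoint-sym (wf-disjoint wfy)) (wf-disjoint wf)
      (wf-valid (wf-left wfy)) (wf-valid (wf-right wf)) pu pz
    where
    wfy : WellFormed (node a u)
    wfy = wf-left wf
  point-allowed R L {node b (node u a)} wf refl refl pu pz =
    a , b , refl , refl ,
    point-siblings-valid ↭-refl (++-comm (edges F b) (edges F (node u a)))
      (centre-meet wfy) (meetAt-sym (centre-meet wf))
      (wf-disjoint wfy) (disjoint-sym (wf-disjoint wf))
      (wf-valid (wf-right wfy)) (wf-valid (wf-left wf)) pu pz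
    where
    wfy : WellFormed (node u a)
    wfy = wf-right wf
  point-allowed R R {node b (node a u)} wf refl refl pu pz =
    a , b , refl , refl ,
    point-siblings-valid (++-comm (edges F a) (edges F u))
      (++-comm (edges F b) (edges F (node a u)))
      (meetAt-sym (centre-meet wfy)) (meetAt-sym (centre-meet wf))
      (disjoint-sym (wf-disjoint wfy)) (disjoint-sym (wf-disjoint wf))
      (wf-valid (wf-left wfy)) (wf-valid (wf-left wf)) pu pz
    where
    wfy : WellFormed (node a u)
    wfy = wf-right wf
  point-allowed L _ {node (leaf _ _ _) _} _ refl ()
  point-allowed R _ {node _ (leaf _ _ _)} _ refl ()

  -- The second rotation of a zig-zag step: after rotate_up(a) the parent of x is node l x
  -- (node x r when mirrored), whose sibling is a.
  zig-zag-allowed : ∀ s {gg g p x s'} → WellFormed gg → child F s gg ≡ just g →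
    child F (flip F s) g ≡ just p → child F s' p ≡ just x →
    PathCluster F (edges F p) → PathCluster F (edges F g) ⊎ PointCluster F (edges F gg) →
    Allowed F (modChild F s (rotLocal F (flip F s) (flip F s)) gg) ((root ▹ s) ▹ s)
  zig-zag-allowed L {node (node l (node x a)) b} wf refl refl _ p-path shape =
    a , b , refl , refl ,
    siblings-valid (↭-sym (++-assoc (edges F l) (edges F x) (edges F a))) ↭-refl
      (meetAt-++ (centre-meet wfg) (centre-meet wfp) (xs⊆ys++xs (edges F a) (edges F x))
        (leftmost-touches-left {x} {a} (central-leftmost wfg (centre-central wfg))))
      (centre-meet wf) (rightmost-touches-right-grandchild wfg p-path cgg-rightmost)
      (wf-valid (wf-right wfp)) (wf-valid (wf-right wf)) (wf-valid wf) (Sum.map₁ (_, outer) shape)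
    where
    wfg : WellFormed (node l (node x a))
    wfg = wf-left wf

    wfp : WellFormed (node x a)
    wfp = wf-right wfg

    cgg-rightmost : Rightmost F (node l (node x a)) (centre wf)
    cgg-rightmost = central-rightmost wf (centre-central wf)

    outer : OnlyBoundaryAwayFrom (edges F (node l (node x a))) (edges F l ++ edges F x) (edges F a)
              (centre wf)
    outer qg _ q∉lx = rightmost-unique wfg
      (rightmost-of-boundary {l} {node x a} qg
        (q∉lx ∘ touches-mono (xs⊆xs++ys (edges F l) (edges F x))))
      cgg-rightmost
  zig-zag-allowed R {node b (node (node a x) r)} wf refl refl _ p-path shape =
    a , b , refl , refl ,
    siblings-valid g↭rxa (++-comm (edges F b) (edges F (node (node a x) r)))
      (meetAt-++ (meetAt-sym (centre-meet wfg)) (meetAt-sym (centre-meet wfp))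
        (xs⊆xs++ys (edges F a) (edges F x))
        (rightmost-touches-right {a} {x} (central-rightmost wfg (centre-central wfg))))
      (meetAt-sym (centre-meet wf)) (leftmost-touches-left-grandchild wfg p-path cgg-leftmost)
      (wf-valid (wf-left wfp)) (wf-valid (wf-left wf)) (wf-valid wf) (Sum.map₁ (_, outer) shape)
    where
    wfg : WellFormed (node (node a x) r)
    wfg = wf-right wf

    wfp : WellFormed (node a x)
    wfp = wf-left wfg

    cgg-leftmost : Leftmost F (node (node a x) r) (centre wf)
    cgg-leftmost = central-leftmost wf (centre-central wf)

    g↭rxa : (edges F a ++ edges F x) ++ edges F r ↭ (edges F r ++ edges F x) ++ edges F a
    g↭rxa = begin
      (Ea ++ Ex) ++ Er ↭⟨ ++-comm (Ea ++ Ex) Er ⟩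
      Er ++ (Ea ++ Ex) ↭⟨ ++⁺ˡ Er (++-comm Ea Ex) ⟩
      Er ++ (Ex ++ Ea) ↭⟨ ↭-sym (++-assoc Er Ex Ea) ⟩
      (Er ++ Ex) ++ Ea ∎
      where
      open PermutationReasoning
      Ea Ex Er : List (E F)
      Ea = edges F a
      Ex = edges F x
      Er = edges F r

    outer : OnlyBoundaryAwayFrom (edges F (node (node a x) r)) (edges F r ++ edges F x) (edges F a)
              (centre wf)
    outer qg _ q∉rx = leftmost-unique wfg
      (leftmost-of-boundary {node a x} {r} qg
        (q∉rx ∘ touches-mono (xs⊆xs++ys (edges F r) (edges F x))))
      cgg-leftmost
  zig-zag-allowed L {node (node _ (leaf _ _ _)) _} _ refl refl ()
  zig-zag-allowed R {node _ (node (leaf _ _ _) _)} _ refl refl ()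

  at-▹ : ∀ t a s → at F t (a ▹ s) ≡ (at F t a >>= child F s)
  at-▹ t a s with at F t a
  ... | just _  = refl
  ... | nothing = refl

  at-▹-cong : ∀ {t t' a a'} s → at F t a ≡ at F t' a' → at F t (a ▹ s) ≡ at F t' (a' ▹ s)
  at-▹-cong {t} {t'} {a} {a'} s eq = begin
    at F t (a ▹ s)           ≡⟨ at-▹ t a s ⟩
    (at F t a >>= child F s) ≡⟨ cong (_>>= child F s) eq ⟩
    (at F t' a' >>= child F s) ≡⟨ sym (at-▹ t' a' s) ⟩
    at F t' (a' ▹ s)         ∎
    where open ≡-Reasoning

  at-parent : ∀ t a s {c} → at F t (a ▹ s) ≡ just c →
    ∃[ d ] (at F t a ≡ just d × child F s d ≡ just c)
  at-parent t a s eq with at F t a | at-▹ t a s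
  ... | just d  | eq' = d , refl , trans (sym eq') eq
  ... | nothing | eq' with () ← trans (sym eq') eq

  parent-node : ∀ {t} a s → IsNode F t (a ▹ s) → IsNode F t a
  parent-node {t} a s (_ , eq) with at-parent t a s eq
  ... | d , ed , _ = d , ed

  cluster-at : ∀ {P : TT F → Set} t a {c} → at F t a ≡ just c →
    ∃[ c' ] (at F t a ≡ just c' × P c') → P c
  cluster-at _ _ eq (_ , eq' , pc) with trans (sym eq) eq'
  ... | refl = pc

  map-modChild-child : ∀ s h m →
    (Maybe.map (modChild F s h) m >>= child F s) ≡ Maybe.map h (m >>= child F s)
  map-modChild-child _ _ nothing                  = refl
  map-modChild-child L _ (just (leaf _ _ _)) = refl
  map-modChild-child R _ (just (leaf _ _ _)) = refl
  map-modChild-child L _ (just (node _ _))   = refl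
  map-modChild-child R _ (just (node _ _))   = refl

  at-modify : ∀ a h t → at F (modify F a h t) a ≡ Maybe.map h (at F t a)
  at-modify root h t = refl
  at-modify (a ▹ s) h t = begin
    at F (modify F a (modChild F s h) t) (a ▹ s)          ≡⟨ at-▹ _ a s ⟩
    (at F (modify F a (modChild F s h) t) a >>= child F s)
      ≡⟨ cong (_>>= child F s) (at-modify a _ t) ⟩
    (Maybe.map (modChild F s h) (at F t a) >>= child F s)
      ≡⟨ map-modChild-child s h (at F t a) ⟩
    Maybe.map h (at F t a >>= child F s)
      ≡⟨ cong (Maybe.map h) (sym (at-▹ t a s)) ⟩
    Maybe.map h (at F t (a ▹ s))
      ∎
    where open ≡-Reasoning

  wf-child : ∀ s {d c} → WellFormed d → child F s d ≡ just c → WellFormed c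
  wf-child L {node _ _} wf refl = wf-left wf
  wf-child R {node _ _} wf refl = wf-right wf

  wf-at : ∀ a {t c} → WellFormed t → at F t a ≡ just c → WellFormed c
  wf-at root wf refl = wf
  wf-at (a ▹ s) {t} wf eq with at-parent t a s eq
  ... | _ , ed , edc = wf-child s (wf-at a wf ed) edc

  allowed-below : ∀ t z {zn s₁ s₂} → at F t z ≡ just zn → Allowed F zn ((root ▹ s₁) ▹ s₂) →
    Allowed F t ((z ▹ s₁) ▹ s₂)
  allowed-below t z {zn} {s₁} {s₂} ez (a , b , ea , eb , vab) =
    a , b , trans at-a ea , trans (at-▹-cong {t} {zn} {z} {root} (flip F s₁) ez) eb , vab
    where
    at-a : at F t ((z ▹ s₁) ▹ flip F s₂) ≡ at F zn ((root ▹ s₁) ▹ flip F s₂)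
    at-a = at-▹-cong {t} {zn} {z ▹ s₁} {root ▹ s₁} (flip F s₂)
             (at-▹-cong {t} {zn} {z} {root} s₁ ez)

  point-step-allowed : ∀ {t} g sp sx → WellFormed t →
    PointAt F t ((g ▹ sp) ▹ sx) → PointAt F t g → Allowed F t ((g ▹ sp) ▹ sx)
  point-step-allowed {t} g sp sx wf (_ , ex , x-point) g-point with at-parent t (g ▹ sp) sx ex
  ... | _ , ep , epx with at-parent t g sp ep
  ...   | _ , eg , egp = allowed-below t g eg
    (point-allowed sp sx (wf-at g wf eg) egp epx x-point (cluster-at t g eg g-point))

  same-side-step-allowed : ∀ {t} z s s' → WellFormed t → IsNode F t ((z ▹ s) ▹ s') →
    PathAt F t (z ▹ s) ⊎ PointAt F t z → Allowed F t ((z ▹ s) ▹ s)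
  same-side-step-allowed {t} z s s' wf (_ , eu) shape with at-parent t (z ▹ s) s' eu
  ... | _ , ey , eyu with at-parent t z s ey
  ...   | _ , ez , ezy = allowed-below t z ez (same-side-allowed s (wf-at z wf ez) ezy eyu
    (Sum.map (cluster-at t (z ▹ s) ey) (cluster-at t z ez) shape))

  zig-zag-step-allowed : ∀ {t} gg s s' → WellFormed t → IsNode F t (((gg ▹ s) ▹ flip F s) ▹ s') →
    PathAt F t ((gg ▹ s) ▹ flip F s) → PathAt F t (gg ▹ s) ⊎ PointAt F t gg →
    Allowed F (rotateUp F t (((gg ▹ s) ▹ flip F s) ▹ flip F s)) ((gg ▹ s) ▹ s)
  zig-zag-step-allowed {t} gg s s' wf (_ , ex) p-path shape
    with at-parent t ((gg ▹ s) ▹ flip F s) s' ex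
  ... | _ , ep , epx with at-parent t (gg ▹ s) (flip F s) ep
  ...   | _ , eg , egp with at-parent t gg s eg
  ...     | _ , egg , eggg = allowed-below _ gg
    (trans (at-modify gg _ t) (cong (Maybe.map _) egg))
    (zig-zag-allowed s (wf-at gg wf egg) eggg egp epx
      (cluster-at t ((gg ▹ s) ▹ flip F s) ep p-path)
      (Sum.map (cluster-at t (gg ▹ s) eg) (cluster-at t gg egg) shape))

lemma5p1 : (F : Forest) → IsForest F →
    (t : TT F) → IsTopTreeOfTreeOfF F t → AllValid F t → OrientInv F t →
    (x : Addr F) → IsNode F t x →
    (rs : List (Rot F)) → SemiSplay F t x rs →
    All (λ r → Allowed F (proj₁ r) (proj₂ r)) rs
lemma5p1 F _ t (_ , unique , _) valid orient _ x-node _ steps = allowed steps x-node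
  where
  open TopTreeRotations F

  wf : WellFormed t
  wf = well-formed unique valid orient

  allowed : ∀ {x rs} → SemiSplay F t x rs → IsNode F t x →
    All (λ r → Allowed F (proj₁ r) (proj₂ r)) rs
  allowed ss-noParent     _ = []
  allowed (ss-noGrand _)  _ = []
  allowed (ss-noGG _ _ _) _ = []
  allowed (ss-point g sp sx x-point g-point) _ = point-step-allowed g sp sx wf x-point g-point ∷ []
  allowed (ss-same gg sg sp _ _ p-path _ refl) x-node =
    same-side-step-allowed (gg ▹ sg) sp sp wf x-node (inj₁ p-path) ∷ []
  allowed (ss-pg gg sg _ sx _ _ shape _ refl) x-node =
    same-side-step-allowed gg sg sg wf (parent-node ((gg ▹ sg) ▹ sg) sx x-node) shape ∷ []
  allowed (ss-double gg L R L _ p-path shape _ _) x-node =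
    same-side-step-allowed (gg ▹ L) R L wf x-node (inj₁ p-path) ∷
    zig-zag-step-allowed gg L L wf x-node p-path shape ∷ []
  allowed (ss-double gg R L R _ p-path shape _ _) x-node =
    same-side-step-allowed (gg ▹ R) L R wf x-node (inj₁ p-path) ∷
    zig-zag-step-allowed gg R R wf x-node p-path shape ∷ []
  allowed (ss-double _ L L _ _ _ _ _ p≢g) _ = ⊥-elim (p≢g refl)
  allowed (ss-double _ R R _ _ _ _ _ p≢g) _ = ⊥-elim (p≢g refl)
  allowed (ss-double _ L R R _ _ _ x≢p _) _ = ⊥-elim (x≢p refl)
  allowed (ss-double _ R L L _ _ _ x≢p _) _ = ⊥-elim (x≢p refl)
  allowed (ss-recurse gg sg sp sx _ _ steps) x-node =
    allowed steps (parent-node ((gg ▹ sg) ▹ sp) sx x-node)
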